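{- Let $n$ and $k$ be positive integers with $n\geq 2k$ and $\gcd(n,k)\geq 3$. Then the generalized Petersen graph $GP(n,k)$ satisfies $\chi'_s(GP(n,k))\leq 5$.
   Context: For integers $n,k$ with $n\geq 2k\geq 2$, the generalized Petersen graph $GP(n,k)$ is the simple graph with vertex set $\{u_0,\ldots,u_{n-1}\}\cup\{v_0,\ldots,v_{n-1}\}$ and edge set $\{u_iu_{i+1}:0\le i\le n-1\}\cup\{v_iv_{i+k}:0\le i\le n-1\}\cup\{u_iv_i:0\le i\le n-1\}$, indices taken modulo $n$. A $k$-star edge coloring of a graph is a proper edge coloring using at most $k$ colors such that no path and no cycle with four edges is bicolored (i.e. colored with only two colors). The star chromatic index $\chi'_s(G)$ is the smallest $k$ such that $G$ admits a $k$-star edge coloring. -}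

module Defs where

open import Data.Nat using (ℕ; NonZero; _+_)
open import Data.Nat.DivMod using (_%_)
open import Data.Fin using (Fin; toℕ)
open import Data.Product using (_×_; ∃₂)
open import Data.Sum using (_⊎_)
open import Relation.Binary.PropositionalEquality using (_≡_; _≢_)

data GPVertex (n : ℕ) : Set where
  u : Fin n → GPVertex n
  v : Fin n → GPVertex n

_≡_+_mod_ : ∀ {n} → Fin n → Fin n → ℕ → (n' : ℕ) → .{{NonZero n'}} → Set
j ≡ i + s mod n' = toℕ j ≡ (toℕ i + s) % n'

GPAdj : (n k : ℕ) → .{{NonZero n}} → GPVertex n → GPVertex n → Set
GPAdj n k (u i) (u j) = (j ≡ i + 1 mod n) ⊎ (i ≡ j + 1 mod n)
GPAdj n k (v i) (v j) = (j ≡ i + k mod n) ⊎ (i ≡ j + k mod n)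
GPAdj n k (u i) (v j) = i ≡ j
GPAdj n k (v i) (u j) = i ≡ j

-- An edge coloring with colors in C assigns a color to every ordered pair,
-- and is required to be symmetric on edges (so it colors unordered edges).
module _ {V : Set} (Adj : V → V → Set) {C : Set} (col : V → V → C) where

  Symmetric-on-edges : Set
  Symmetric-on-edges = ∀ x y → Adj x y → col x y ≡ col y x

  Proper : Set
  Proper = ∀ x y z → Adj x y → Adj x z → y ≢ z → col x y ≢ col x z

  private
    In2 : C → C → C → Set
    In2 a b c = c ≡ a ⊎ c ≡ b

  NoBicoloredP4 : Set
  NoBicoloredP4 = ∀ x0 x1 x2 x3 x4 →
    x0 ≢ x1 → x0 ≢ x2 → x0 ≢ x3 → x0 ≢ x4 →
    x1 ≢ x2 → x1 ≢ x3 → x1 ≢ x4 →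
    x2 ≢ x3 → x2 ≢ x4 → x3 ≢ x4 →
    Adj x0 x1 → Adj x1 x2 → Adj x2 x3 → Adj x3 x4 →
    ∀ a b → In2 a b (col x0 x1) → In2 a b (col x1 x2) →
            In2 a b (col x2 x3) → In2 a b (col x3 x4) → Data.Empty.⊥
    where import Data.Empty

  NoBicoloredC4 : Set
  NoBicoloredC4 = ∀ x0 x1 x2 x3 →
    x0 ≢ x1 → x0 ≢ x2 → x0 ≢ x3 → x1 ≢ x2 → x1 ≢ x3 → x2 ≢ x3 →
    Adj x0 x1 → Adj x1 x2 → Adj x2 x3 → Adj x3 x0 →
    ∀ a b → In2 a b (col x0 x1) → In2 a b (col x1 x2) →
            In2 a b (col x2 x3) → In2 a b (col x3 x0) → Data.Empty.⊥
    where import Data.Empty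

  IsStarEdgeColoring : Set
  IsStarEdgeColoring = Symmetric-on-edges × Proper × NoBicoloredP4 × NoBicoloredC4

StarChromaticIndex≤ : {V : Set} → (V → V → Set) → ℕ → Set
StarChromaticIndex≤ {V} Adj m =
  Data.Product.∃ λ (col : V → V → Fin m) → IsStarEdgeColoring Adj col
  where import Data.Product

{-# OPTIONS --safe #-}
-- Write d = gcd n k, n = N d, k = K d, and let K⁻¹ be an inverse of K modulo N.  Place
-- the index a = q d + r at position p = q K⁻¹ mod N of row r.  Then the inner edge
-- v_a v_{a+k} advances p by one within row r, while the outer edge u_a u_{a+1} advances
-- r by one, except that from the last row r = d − 1 it re-enters row 0 at position
-- p + K⁻¹.  Each vertex is labelled by its side, a state determined by p (the inner
-- N-cycle is cut into blocks of lengths 3 and 4, with special patterns for N = 2 and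
-- N = 5) and the type of its row (first, last or middle, the latter two indexed by
-- r mod 3).  Colouring every edge by a table entry at the label of its forward endpoint
-- colours a finite graph of labels, and evaluation checks that this colouring is proper
-- and has no bicoloured non-backtracking walk with four edges.  Distinct neighbours of a
-- vertex are reached by distinct moves of the label graph, so both properties lift to
-- GP(n,k).
module Submission where

open import Defs
open import Data.Bool using (Bool; true; false; if_then_else_)
open import Data.Empty using (⊥)
open import Data.Fin using (Fin; zero; suc; toℕ; #_)
import Data.Fin.Properties as Fin
open import Data.Nat
  using (ℕ; zero; suc; _+_; _*_; _∸_; _≤_; _<_; _%_; _/_; NonZero; z≤n; s≤s; _≟_; _<?_; >-nonZero; >-nonZero⁻¹)
open import Data.Nat.Properties
open import Data.Nat.DivMod hiding (_mod_)
open import Data.Nat.Divisibility using (divides; divides-refl; ∣-refl; n∣m*n; ∣⇒≤)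
open import Data.Nat.Coprimality using (Coprime; coprime-Bézout; coprime-/gcd)
open import Data.Nat.GCD using (gcd; gcd[m,n]∣m; gcd[m,n]∣n; module Bézout)
open import Data.Nat.Solver using (module +-*-Solver)
open import Data.List using (List; []; _∷_; map; concatMap)
open import Data.List.Membership.Propositional using (_∈_)
open import Data.List.Membership.Propositional.Properties using (∈-map⁺)
import Data.List.Membership.DecPropositional as DecMembership
open import Data.List.Relation.Unary.All as All using (All; []; _∷_)
open import Data.List.Relation.Unary.Any using (here; there)
open import Data.Product using (_×_; _,_; ∃; ∃₂)
open import Data.Product.Properties using (≡-dec)
open import Data.Sum using (_⊎_; inj₁; inj₂)
open import Data.Vec using (Vec; _∷_; []; lookup)
open import Function using (id)
open import Function.Bundles using (_⇔_; mk⇔)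
open import Relation.Binary.Definitions using (DecidableEquality)
open import Relation.Binary.PropositionalEquality
  using (_≡_; _≢_; refl; sym; trans; cong; cong₂; subst; subst₂; module ≡-Reasoning)
open import Relation.Nullary using (¬_; Dec; yes; no; does; ¬?; _×-dec_; _→-dec_; map′; contradiction)
open import Relation.Nullary.Decidable using (toWitness; dec-true; dec-false; does-⇔)
open ≡-Reasoning

-- Lifting a star colouring of a finite model along a cover

bicoloured-alternates : ∀ {A : Set} {a b c₀ c₁ c₂ : A} →
  c₀ ≡ a ⊎ c₀ ≡ b → c₁ ≡ a ⊎ c₁ ≡ b → c₂ ≡ a ⊎ c₂ ≡ b → c₀ ≢ c₁ → c₁ ≢ c₂ → c₀ ≡ c₂
bicoloured-alternates (inj₁ refl) (inj₁ refl) _          c₀≢c₁ _     = contradiction refl c₀≢c₁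
bicoloured-alternates (inj₁ refl) (inj₂ refl) (inj₁ refl) _    _     = refl
bicoloured-alternates (inj₁ refl) (inj₂ refl) (inj₂ refl) _    c₁≢c₂ = contradiction refl c₁≢c₂
bicoloured-alternates (inj₂ refl) (inj₁ refl) (inj₁ refl) _    c₁≢c₂ = contradiction refl c₁≢c₂
bicoloured-alternates (inj₂ refl) (inj₁ refl) (inj₂ refl) _    _     = refl
bicoloured-alternates (inj₂ refl) (inj₂ refl) _          c₀≢c₁ _     = contradiction refl c₀≢c₁

module StarModel {Label Move Colour : Set}
  (step : Label → Move → List Label) (back : Label → Move → Move)
  (colour : Label → Move → Label → Colour) where

  record IsStarModel : Set where
    field
      back-converse : ∀ l t → All (λ l′ → l ∈ step l′ (back l′ t)) (step l t)
      colour-symmetric : ∀ l t → All (λ l′ → colour l t l′ ≡ colour l′ (back l′ t) l) (step l t)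
      moves-distinctly-coloured : ∀ l t t′ → t ≢ t′ →
        All (λ l₁ → All (λ l₂ → colour l t l₁ ≢ colour l t′ l₂) (step l t′)) (step l t)
      no-alternating-walk :
        ∀ l₀ t₁ → All (λ l₁ →
        ∀ t₂ → t₂ ≢ back l₁ t₁ → All (λ l₂ →
        ∀ t₃ → t₃ ≢ back l₂ t₂ → All (λ l₃ →
        colour l₀ t₁ l₁ ≡ colour l₂ t₃ l₃ →
        ∀ t₄ → t₄ ≢ back l₃ t₃ → All (λ l₄ →
        colour l₁ t₂ l₂ ≢ colour l₃ t₄ l₄)
        (step l₃ t₄)) (step l₂ t₃)) (step l₁ t₂)) (step l₀ t₁)

  record Cover {V : Set} (Adj : V → V → Set) : Set where
    field
      label : V → Label
      move : V → V → Move
      adj-sym : ∀ {x y} → Adj x y → Adj y x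
      move-injective : ∀ {x y z} → Adj x y → Adj x z → move x y ≡ move x z → y ≡ z
      move-back : ∀ {x y} → Adj x y → move y x ≡ back (label y) (move x y)
      covered : ∀ {x y} → Adj x y →
        label y ∈ step (label x) (move x y) ⊎ label x ∈ step (label y) (move y x)

    colouring : V → V → Colour
    colouring x y = colour (label x) (move x y) (label y)

  module Lift (model : IsStarModel) {V : Set} {Adj : V → V → Set} (cover : Cover Adj) where
    open IsStarModel model
    open Cover cover

    steps : ∀ {x y} → Adj x y → label y ∈ step (label x) (move x y)
    steps a with covered a
    ... | inj₁ s = s
    ... | inj₂ s = subst (λ t → _ ∈ step _ t) (sym (move-back (adj-sym a)))
                         (All.lookup (back-converse _ _) s)

    symmetric : Symmetric-on-edges Adj colouring
    symmetric x y a = trans (All.lookup (colour-symmetric _ _) (steps a))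
                            (cong (λ t → colour (label y) t (label x)) (sym (move-back a)))

    proper : Proper Adj colouring
    proper x y z a b y≢z = All.lookup (All.lookup
      (moves-distinctly-coloured _ _ _ (λ e → y≢z (move-injective a b e))) (steps a)) (steps b)

    consecutive-distinct : ∀ {x y z} → Adj x y → Adj y z → x ≢ z → colouring x y ≢ colouring y z
    consecutive-distinct {x} {y} {z} a b x≢z e =
      proper y x z (adj-sym a) b x≢z (trans (symmetric y x (adj-sym a)) e)

    no-u-turn : ∀ {x y z} → Adj x y → Adj y z → x ≢ z → move y z ≢ back (label y) (move x y)
    no-u-turn a b x≢z e = x≢z (move-injective (adj-sym a) b (trans (move-back a) (sym e)))

    lifted-walk-not-alternating : ∀ {x₀ x₁ x₂ x₃ x₄} →
      Adj x₀ x₁ → Adj x₁ x₂ → Adj x₂ x₃ → Adj x₃ x₄ → x₀ ≢ x₂ → x₁ ≢ x₃ → x₂ ≢ x₄ →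
      colouring x₀ x₁ ≡ colouring x₂ x₃ → colouring x₁ x₂ ≢ colouring x₃ x₄
    lifted-walk-not-alternating a₀₁ a₁₂ a₂₃ a₃₄ x₀≢x₂ x₁≢x₃ x₂≢x₄ c₀₁≡c₂₃ =
      All.lookup (All.lookup (All.lookup (All.lookup (no-alternating-walk _ _)
        (steps a₀₁) _ (no-u-turn a₀₁ a₁₂ x₀≢x₂))
        (steps a₁₂) _ (no-u-turn a₁₂ a₂₃ x₁≢x₃))
        (steps a₂₃) c₀₁≡c₂₃ _ (no-u-turn a₂₃ a₃₄ x₂≢x₄))
        (steps a₃₄)

    no-bicoloured-walk : ∀ {x₀ x₁ x₂ x₃ x₄ a b} →
      Adj x₀ x₁ → Adj x₁ x₂ → Adj x₂ x₃ → Adj x₃ x₄ → x₀ ≢ x₂ → x₁ ≢ x₃ → x₂ ≢ x₄ →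
      colouring x₀ x₁ ≡ a ⊎ colouring x₀ x₁ ≡ b → colouring x₁ x₂ ≡ a ⊎ colouring x₁ x₂ ≡ b →
      colouring x₂ x₃ ≡ a ⊎ colouring x₂ x₃ ≡ b → colouring x₃ x₄ ≡ a ⊎ colouring x₃ x₄ ≡ b → ⊥
    no-bicoloured-walk a₀₁ a₁₂ a₂₃ a₃₄ x₀≢x₂ x₁≢x₃ x₂≢x₄ i₁ i₂ i₃ i₄ =
      lifted-walk-not-alternating a₀₁ a₁₂ a₂₃ a₃₄ x₀≢x₂ x₁≢x₃ x₂≢x₄
        (bicoloured-alternates i₁ i₂ i₃ c₀₁≢c₁₂ c₁₂≢c₂₃)
        (bicoloured-alternates i₂ i₃ i₄ c₁₂≢c₂₃ (consecutive-distinct a₂₃ a₃₄ x₂≢x₄))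
      where
      c₀₁≢c₁₂ = consecutive-distinct a₀₁ a₁₂ x₀≢x₂
      c₁₂≢c₂₃ = consecutive-distinct a₁₂ a₂₃ x₁≢x₃

    no-bicoloured-P4 : NoBicoloredP4 Adj colouring
    no-bicoloured-P4 _ _ _ _ _ _ x₀≢x₂ _ _ _ x₁≢x₃ _ _ x₂≢x₄ _ a₀₁ a₁₂ a₂₃ a₃₄ _ _ =
      no-bicoloured-walk a₀₁ a₁₂ a₂₃ a₃₄ x₀≢x₂ x₁≢x₃ x₂≢x₄

    no-bicoloured-C4 : NoBicoloredC4 Adj colouring
    no-bicoloured-C4 _ _ _ _ _ x₀≢x₂ _ _ x₁≢x₃ _ a₀₁ a₁₂ a₂₃ a₃₀ _ _ =
      no-bicoloured-walk a₀₁ a₁₂ a₂₃ a₃₀ x₀≢x₂ x₁≢x₃ (λ e → x₀≢x₂ (sym e))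

    isStarEdgeColoring : IsStarEdgeColoring Adj colouring
    isStarEdgeColoring = symmetric , proper , no-bicoloured-P4 , no-bicoloured-C4

-- Modular arithmetic

[m%o+n]%o≡[m+n]%o : ∀ m n o .{{_ : NonZero o}} → (m % o + n) % o ≡ (m + n) % o
[m%o+n]%o≡[m+n]%o m n o = begin
  (m % o + n) % o         ≡⟨ %-distribˡ-+ (m % o) n o ⟩
  (m % o % o + n % o) % o ≡⟨ cong (λ z → (z + n % o) % o) (m%n%n≡m%n m o) ⟩
  (m % o + n % o) % o     ≡⟨ %-distribˡ-+ m n o ⟨
  (m + n) % o             ∎

[m+n%o]%o≡[m+n]%o : ∀ m n o .{{_ : NonZero o}} → (m + n % o) % o ≡ (m + n) % o
[m+n%o]%o≡[m+n]%o m n o = begin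
  (m + n % o) % o ≡⟨ cong (_% o) (+-comm m (n % o)) ⟩
  (n % o + m) % o ≡⟨ [m%o+n]%o≡[m+n]%o n m o ⟩
  (n + m) % o     ≡⟨ cong (_% o) (+-comm n m) ⟩
  (m + n) % o     ∎

[m%o*n]%o≡[m*n]%o : ∀ m n o .{{_ : NonZero o}} → (m % o * n) % o ≡ (m * n) % o
[m%o*n]%o≡[m*n]%o m n o = begin
  (m % o * n) % o             ≡⟨ %-distribˡ-* (m % o) n o ⟩
  (m % o % o * (n % o)) % o   ≡⟨ cong (λ z → (z * (n % o)) % o) (m%n%n≡m%n m o) ⟩
  (m % o * (n % o)) % o       ≡⟨ %-distribˡ-* m n o ⟨
  (m * n) % o                 ∎

%-cancelʳ-+ : ∀ {a b} s n .{{_ : NonZero n}} → a < n → b < n → (a + s) % n ≡ (b + s) % n → a ≡ b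
%-cancelʳ-+ {a} {b} s n a<n b<n eq = begin
  a                        ≡⟨ undo a<n ⟨
  ((a + s) % n + s′) % n   ≡⟨ cong (λ z → (z + s′) % n) eq ⟩
  ((b + s) % n + s′) % n   ≡⟨ undo b<n ⟩
  b                        ∎
  where
  s′ = n ∸ s % n
  s+s′≡0 : (s + s′) % n ≡ 0
  s+s′≡0 = begin
    (s + s′) % n     ≡⟨ [m%o+n]%o≡[m+n]%o s s′ n ⟨
    (s % n + s′) % n ≡⟨ cong (_% n) (m+[n∸m]≡n (m%n≤n s n)) ⟩
    n % n            ≡⟨ n%n≡0 n ⟩
    0                ∎
  undo : ∀ {c} → c < n → ((c + s) % n + s′) % n ≡ c
  undo {c} c<n = begin
    ((c + s) % n + s′) % n ≡⟨ [m%o+n]%o≡[m+n]%o (c + s) s′ n ⟩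
    (c + s + s′) % n       ≡⟨ cong (_% n) (+-assoc c s s′) ⟩
    (c + (s + s′)) % n     ≡⟨ [m+n%o]%o≡[m+n]%o c (s + s′) n ⟨
    (c + (s + s′) % n) % n ≡⟨ cong (λ z → (c + z) % n) s+s′≡0 ⟩
    (c + 0) % n            ≡⟨ cong (_% n) (+-identityʳ c) ⟩
    c % n                  ≡⟨ m<n⇒m%n≡m c<n ⟩
    c                      ∎

a≡[a+m]%n⇔m%n≡0 : ∀ {a} m n .{{_ : NonZero n}} → a < n → a ≡ (a + m) % n ⇔ m % n ≡ 0
a≡[a+m]%n⇔m%n≡0 {a} m n a<n = mk⇔ to from
  where
  to : a ≡ (a + m) % n → m % n ≡ 0
  to eq = %-cancelʳ-+ a n (m%n<n m n) (>-nonZero⁻¹ n) (begin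
    (m % n + a) % n ≡⟨ [m%o+n]%o≡[m+n]%o m a n ⟩
    (m + a) % n     ≡⟨ cong (_% n) (+-comm m a) ⟩
    (a + m) % n     ≡⟨ eq ⟨
    a               ≡⟨ m<n⇒m%n≡m a<n ⟨
    a % n           ∎)
  from : m % n ≡ 0 → a ≡ (a + m) % n
  from m%n≡0 = sym (begin
    (a + m) % n     ≡⟨ [m+n%o]%o≡[m+n]%o a m n ⟨
    (a + m % n) % n ≡⟨ cong (λ z → (a + z) % n) m%n≡0 ⟩
    (a + 0) % n     ≡⟨ cong (_% n) (+-identityʳ a) ⟩
    a % n           ≡⟨ m<n⇒m%n≡m a<n ⟩
    a               ∎)

1+m≡1+m%n+[m/n]*n : ∀ m n .{{_ : NonZero n}} → suc m ≡ suc (m % n) + m / n * n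
1+m≡1+m%n+[m/n]*n m n = cong suc (m≡m%n+[m/n]*n m n)

[1+m]%n≡[1+m%n]%n : ∀ m n .{{_ : NonZero n}} → suc m % n ≡ suc (m % n) % n
[1+m]%n≡[1+m%n]%n m n =
  trans (cong (_% n) (1+m≡1+m%n+[m/n]*n m n)) ([m+kn]%n≡m%n (suc (m % n)) (m / n) n)

[1+m]/n≡[1+m%n]/n+m/n : ∀ m n .{{_ : NonZero n}} → suc m / n ≡ suc (m % n) / n + m / n
[1+m]/n≡[1+m%n]/n+m/n m n = begin
  suc m / n                           ≡⟨ cong (_/ n) (1+m≡1+m%n+[m/n]*n m n) ⟩
  (suc (m % n) + m / n * n) / n       ≡⟨ +-distrib-/-∣ʳ (suc (m % n)) (divides-refl (m / n)) ⟩
  suc (m % n) / n + m / n * n / n     ≡⟨ cong (suc (m % n) / n +_) (m*n/n≡m (m / n) n) ⟩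
  suc (m % n) / n + m / n             ∎

-- The finite model

Colour : Set
Colour = Fin 5

-- States of a position on an inner cycle: a for N = 2, x and y for blocks of lengths 3
-- and 4, p and q for N = 5 with K⁻¹ ≡ 1 and K⁻¹ ≡ 3 (mod 5) respectively.

State : Set
State = Fin 19

pattern a₀ = zero
pattern a₁ = suc a₀
pattern x₀ = suc a₁
pattern x₁ = suc x₀
pattern x₂ = suc x₁
pattern y₀ = suc x₂
pattern y₁ = suc y₀
pattern y₂ = suc y₁
pattern y₃ = suc y₂
pattern p₀ = suc y₃
pattern p₁ = suc p₀
pattern p₂ = suc p₁
pattern p₃ = suc p₂
pattern p₄ = suc p₃
pattern q₀ = suc p₄
pattern q₁ = suc q₀
pattern q₂ = suc q₁
pattern q₃ = suc q₂
pattern q₄ = suc q₃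

Row : Set
Row = Fin 7

pattern first = zero
pattern mid₀ = suc first
pattern mid₁ = suc mid₀
pattern mid₂ = suc mid₁
pattern last₀ = suc mid₂
pattern last₁ = suc last₀
pattern last₂ = suc last₁

data Side : Set where
  outer inner : Side

data Move : Set where
  spoke forward backward : Move

Label : Set
Label = Side × State × Row

blockStarts blockEnds blockStates pairStates : List State
blockStarts = x₀ ∷ y₀ ∷ []
blockEnds = x₂ ∷ y₃ ∷ []
blockStates = x₀ ∷ x₁ ∷ x₂ ∷ y₀ ∷ y₁ ∷ y₂ ∷ y₃ ∷ []
pairStates = a₀ ∷ a₁ ∷ []

innerNext : State → List State
innerNext a₀ = a₁ ∷ []
innerNext a₁ = a₀ ∷ []
innerNext x₀ = x₁ ∷ []
innerNext x₁ = x₂ ∷ []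
innerNext x₂ = blockStarts
innerNext y₀ = y₁ ∷ []
innerNext y₁ = y₂ ∷ []
innerNext y₂ = y₃ ∷ []
innerNext y₃ = blockStarts
innerNext p₀ = p₁ ∷ []
innerNext p₁ = p₂ ∷ []
innerNext p₂ = p₃ ∷ []
innerNext p₃ = p₄ ∷ []
innerNext p₄ = p₀ ∷ []
innerNext q₀ = q₁ ∷ []
innerNext q₁ = q₂ ∷ []
innerNext q₂ = q₃ ∷ []
innerNext q₃ = q₄ ∷ []
innerNext q₄ = q₀ ∷ []

innerPrev : State → List State
innerPrev a₀ = []
innerPrev a₁ = []
innerPrev x₀ = blockEnds
innerPrev x₁ = x₀ ∷ []
innerPrev x₂ = x₁ ∷ []
innerPrev y₀ = blockEnds
innerPrev y₁ = y₀ ∷ []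
innerPrev y₂ = y₁ ∷ []
innerPrev y₃ = y₂ ∷ []
innerPrev p₀ = p₄ ∷ []
innerPrev p₁ = p₀ ∷ []
innerPrev p₂ = p₁ ∷ []
innerPrev p₃ = p₂ ∷ []
innerPrev p₄ = p₃ ∷ []
innerPrev q₀ = q₄ ∷ []
innerPrev q₁ = q₀ ∷ []
innerPrev q₂ = q₁ ∷ []
innerPrev q₃ = q₂ ∷ []
innerPrev q₄ = q₃ ∷ []

-- States at position p + K⁻¹, where the outer cycle re-enters row 0 after leaving
-- position p of the last row.
wrapNext : State → List State
wrapNext a₀ = pairStates
wrapNext a₁ = pairStates
wrapNext p₀ = p₁ ∷ []
wrapNext p₁ = p₂ ∷ []
wrapNext p₂ = p₃ ∷ []
wrapNext p₃ = p₄ ∷ []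
wrapNext p₄ = p₀ ∷ []
wrapNext q₀ = q₃ ∷ []
wrapNext q₁ = q₄ ∷ []
wrapNext q₂ = q₀ ∷ []
wrapNext q₃ = q₁ ∷ []
wrapNext q₄ = q₂ ∷ []
wrapNext _ = blockStates

wrapPrev : State → List State
wrapPrev a₀ = pairStates
wrapPrev a₁ = pairStates
wrapPrev p₀ = p₄ ∷ []
wrapPrev p₁ = p₀ ∷ []
wrapPrev p₂ = p₁ ∷ []
wrapPrev p₃ = p₂ ∷ []
wrapPrev p₄ = p₃ ∷ []
wrapPrev q₀ = q₂ ∷ []
wrapPrev q₁ = q₃ ∷ []
wrapPrev q₂ = q₄ ∷ []
wrapPrev q₃ = q₀ ∷ []
wrapPrev q₄ = q₁ ∷ []
wrapPrev _ = blockStates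

paired : State → Bool
paired a₀ = true
paired a₁ = true
paired _ = false

outerNext : State → Row → List Label
outerNext s first = (outer , s , mid₁) ∷ []
outerNext s mid₀ = (outer , s , mid₁) ∷ (outer , s , last₁) ∷ []
outerNext s mid₁ = (outer , s , mid₂) ∷ (outer , s , last₂) ∷ []
outerNext s mid₂ = (outer , s , mid₀) ∷ (outer , s , last₀) ∷ []
outerNext s _ = map (λ s′ → outer , s′ , first) (wrapNext s)

outerPrev : State → Row → List Label
outerPrev s first =
  concatMap (λ s′ → (outer , s′ , last₀) ∷ (outer , s′ , last₁) ∷ (outer , s′ , last₂) ∷ []) (wrapPrev s)
outerPrev s mid₀ = (outer , s , mid₂) ∷ []
outerPrev s mid₁ = (outer , s , first) ∷ (outer , s , mid₀) ∷ []
outerPrev s mid₂ = (outer , s , mid₁) ∷ []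
outerPrev s last₀ = (outer , s , mid₂) ∷ []
outerPrev s last₁ = (outer , s , mid₀) ∷ []
outerPrev s last₂ = (outer , s , mid₁) ∷ []

opposite : Side → Side
opposite outer = inner
opposite inner = outer

step : Label → Move → List Label
step (side , s , ρ) spoke = (opposite side , s , ρ) ∷ []
step (outer , s , ρ) forward = outerNext s ρ
step (outer , s , ρ) backward = outerPrev s ρ
step (inner , s , ρ) forward = map (λ s′ → inner , s′ , ρ) (innerNext s)
step (inner , s , ρ) backward = map (λ s′ → inner , s′ , ρ) (innerPrev s)

-- The flag says whether a forward move is its own reverse, as happens for the inner
-- edges v_a v_{a+k} when N = 2.
reverse : Bool → Move → Move
reverse _ spoke = spoke
reverse selfReverse forward = if selfReverse then forward else backward
reverse _ backward = forward

back : Label → Move → Move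
back (outer , _) = reverse false
back (inner , s , _) = reverse (paired s)

-- Found by computer search.  Columns: first, mid₀, mid₁, mid₂, last₀, last₁, last₂.
outerColours : State → Vec Colour 7
outerColours a₀ = # 1 ∷ # 1 ∷ # 0 ∷ # 3 ∷ # 4 ∷ # 4 ∷ # 4 ∷ []
outerColours a₁ = # 3 ∷ # 3 ∷ # 0 ∷ # 2 ∷ # 4 ∷ # 4 ∷ # 4 ∷ []
outerColours x₀ = # 3 ∷ # 3 ∷ # 1 ∷ # 0 ∷ # 4 ∷ # 4 ∷ # 4 ∷ []
outerColours x₁ = # 1 ∷ # 1 ∷ # 3 ∷ # 2 ∷ # 4 ∷ # 4 ∷ # 4 ∷ []
outerColours x₂ = # 2 ∷ # 2 ∷ # 0 ∷ # 1 ∷ # 4 ∷ # 4 ∷ # 4 ∷ []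
outerColours y₀ = # 3 ∷ # 3 ∷ # 2 ∷ # 0 ∷ # 4 ∷ # 4 ∷ # 4 ∷ []
outerColours y₁ = # 1 ∷ # 1 ∷ # 3 ∷ # 2 ∷ # 4 ∷ # 4 ∷ # 4 ∷ []
outerColours y₂ = # 1 ∷ # 1 ∷ # 3 ∷ # 2 ∷ # 4 ∷ # 4 ∷ # 4 ∷ []
outerColours y₃ = # 3 ∷ # 3 ∷ # 2 ∷ # 0 ∷ # 4 ∷ # 4 ∷ # 4 ∷ []
outerColours p₀ = # 3 ∷ # 3 ∷ # 2 ∷ # 1 ∷ # 4 ∷ # 0 ∷ # 0 ∷ []
outerColours p₁ = # 3 ∷ # 3 ∷ # 2 ∷ # 4 ∷ # 0 ∷ # 1 ∷ # 1 ∷ []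
outerColours p₂ = # 2 ∷ # 3 ∷ # 0 ∷ # 4 ∷ # 3 ∷ # 4 ∷ # 4 ∷ []
outerColours p₃ = # 1 ∷ # 1 ∷ # 2 ∷ # 3 ∷ # 1 ∷ # 3 ∷ # 3 ∷ []
outerColours p₄ = # 4 ∷ # 0 ∷ # 2 ∷ # 4 ∷ # 0 ∷ # 1 ∷ # 0 ∷ []
outerColours q₀ = # 0 ∷ # 0 ∷ # 3 ∷ # 2 ∷ # 4 ∷ # 4 ∷ # 4 ∷ []
outerColours q₁ = # 4 ∷ # 4 ∷ # 2 ∷ # 1 ∷ # 4 ∷ # 3 ∷ # 3 ∷ []
outerColours q₂ = # 1 ∷ # 0 ∷ # 4 ∷ # 3 ∷ # 2 ∷ # 2 ∷ # 3 ∷ []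
outerColours q₃ = # 0 ∷ # 3 ∷ # 2 ∷ # 0 ∷ # 3 ∷ # 0 ∷ # 0 ∷ []
outerColours q₄ = # 1 ∷ # 1 ∷ # 2 ∷ # 4 ∷ # 0 ∷ # 0 ∷ # 0 ∷ []

spokeColours : State → Vec Colour 7
spokeColours a₀ = # 0 ∷ # 2 ∷ # 2 ∷ # 2 ∷ # 1 ∷ # 3 ∷ # 2 ∷ []
spokeColours a₁ = # 0 ∷ # 0 ∷ # 1 ∷ # 1 ∷ # 1 ∷ # 1 ∷ # 2 ∷ []
spokeColours x₀ = # 0 ∷ # 2 ∷ # 0 ∷ # 2 ∷ # 3 ∷ # 0 ∷ # 2 ∷ []
spokeColours x₁ = # 3 ∷ # 3 ∷ # 0 ∷ # 0 ∷ # 0 ∷ # 3 ∷ # 2 ∷ []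
spokeColours x₂ = # 3 ∷ # 3 ∷ # 3 ∷ # 2 ∷ # 0 ∷ # 3 ∷ # 2 ∷ []
spokeColours y₀ = # 0 ∷ # 2 ∷ # 1 ∷ # 1 ∷ # 3 ∷ # 0 ∷ # 1 ∷ []
spokeColours y₁ = # 0 ∷ # 0 ∷ # 0 ∷ # 1 ∷ # 3 ∷ # 0 ∷ # 1 ∷ []
spokeColours y₂ = # 0 ∷ # 0 ∷ # 0 ∷ # 1 ∷ # 1 ∷ # 0 ∷ # 1 ∷ []
spokeColours y₃ = # 0 ∷ # 2 ∷ # 1 ∷ # 1 ∷ # 1 ∷ # 0 ∷ # 1 ∷ []
spokeColours p₀ = # 4 ∷ # 4 ∷ # 4 ∷ # 0 ∷ # 0 ∷ # 2 ∷ # 3 ∷ []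
spokeColours p₁ = # 1 ∷ # 0 ∷ # 4 ∷ # 1 ∷ # 1 ∷ # 2 ∷ # 0 ∷ []
spokeColours p₂ = # 3 ∷ # 2 ∷ # 4 ∷ # 1 ∷ # 1 ∷ # 0 ∷ # 1 ∷ []
spokeColours p₃ = # 2 ∷ # 0 ∷ # 0 ∷ # 4 ∷ # 2 ∷ # 2 ∷ # 4 ∷ []
spokeColours p₄ = # 0 ∷ # 1 ∷ # 1 ∷ # 3 ∷ # 1 ∷ # 3 ∷ # 3 ∷ []
spokeColours q₀ = # 4 ∷ # 1 ∷ # 4 ∷ # 1 ∷ # 3 ∷ # 2 ∷ # 2 ∷ []
spokeColours q₁ = # 1 ∷ # 3 ∷ # 3 ∷ # 3 ∷ # 2 ∷ # 2 ∷ # 4 ∷ []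
spokeColours q₂ = # 3 ∷ # 4 ∷ # 2 ∷ # 2 ∷ # 1 ∷ # 1 ∷ # 2 ∷ []
spokeColours q₃ = # 1 ∷ # 4 ∷ # 1 ∷ # 4 ∷ # 1 ∷ # 2 ∷ # 3 ∷ []
spokeColours q₄ = # 0 ∷ # 3 ∷ # 3 ∷ # 0 ∷ # 1 ∷ # 4 ∷ # 1 ∷ []

innerColours : State → Vec Colour 7
innerColours a₀ = # 2 ∷ # 4 ∷ # 3 ∷ # 4 ∷ # 0 ∷ # 0 ∷ # 1 ∷ []
innerColours a₁ = # 2 ∷ # 4 ∷ # 3 ∷ # 4 ∷ # 0 ∷ # 0 ∷ # 1 ∷ []
innerColours x₀ = # 2 ∷ # 4 ∷ # 2 ∷ # 1 ∷ # 1 ∷ # 2 ∷ # 0 ∷ []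
innerColours x₁ = # 0 ∷ # 0 ∷ # 1 ∷ # 4 ∷ # 3 ∷ # 0 ∷ # 1 ∷ []
innerColours x₂ = # 1 ∷ # 1 ∷ # 4 ∷ # 3 ∷ # 2 ∷ # 1 ∷ # 3 ∷ []
innerColours y₀ = # 2 ∷ # 4 ∷ # 3 ∷ # 4 ∷ # 1 ∷ # 2 ∷ # 0 ∷ []
innerColours y₁ = # 3 ∷ # 3 ∷ # 2 ∷ # 0 ∷ # 0 ∷ # 3 ∷ # 2 ∷ []
innerColours y₂ = # 2 ∷ # 4 ∷ # 3 ∷ # 4 ∷ # 3 ∷ # 2 ∷ # 0 ∷ []
innerColours y₃ = # 1 ∷ # 1 ∷ # 4 ∷ # 3 ∷ # 2 ∷ # 1 ∷ # 3 ∷ []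
innerColours p₀ = # 2 ∷ # 1 ∷ # 0 ∷ # 2 ∷ # 3 ∷ # 4 ∷ # 4 ∷ []
innerColours p₁ = # 0 ∷ # 3 ∷ # 1 ∷ # 3 ∷ # 2 ∷ # 3 ∷ # 3 ∷ []
innerColours p₂ = # 4 ∷ # 4 ∷ # 2 ∷ # 2 ∷ # 0 ∷ # 1 ∷ # 0 ∷ []
innerColours p₃ = # 3 ∷ # 3 ∷ # 3 ∷ # 1 ∷ # 4 ∷ # 4 ∷ # 2 ∷ []
innerColours p₄ = # 1 ∷ # 2 ∷ # 2 ∷ # 4 ∷ # 2 ∷ # 0 ∷ # 1 ∷ []
innerColours q₀ = # 2 ∷ # 0 ∷ # 1 ∷ # 4 ∷ # 0 ∷ # 1 ∷ # 0 ∷ []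
innerColours q₁ = # 0 ∷ # 2 ∷ # 0 ∷ # 0 ∷ # 3 ∷ # 4 ∷ # 3 ∷ []
innerColours q₂ = # 4 ∷ # 1 ∷ # 3 ∷ # 1 ∷ # 4 ∷ # 3 ∷ # 1 ∷ []
innerColours q₃ = # 3 ∷ # 2 ∷ # 4 ∷ # 2 ∷ # 2 ∷ # 0 ∷ # 4 ∷ []
innerColours q₄ = # 1 ∷ # 4 ∷ # 2 ∷ # 3 ∷ # 4 ∷ # 3 ∷ # 3 ∷ []

sideColours : Side → State → Vec Colour 7
sideColours outer = outerColours
sideColours inner = innerColours

colour : Label → Move → Label → Colour
colour (_ , s , ρ) spoke _ = lookup (spokeColours s) ρ
colour (side , s , ρ) forward _ = lookup (sideColours side s) ρ
colour _ backward (side , s , ρ) = lookup (sideColours side s) ρ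

_≟-side_ : DecidableEquality Side
outer ≟-side outer = yes refl
outer ≟-side inner = no λ ()
inner ≟-side outer = no λ ()
inner ≟-side inner = yes refl

_≟-move_ : DecidableEquality Move
spoke ≟-move spoke = yes refl
spoke ≟-move forward = no λ ()
spoke ≟-move backward = no λ ()
forward ≟-move spoke = no λ ()
forward ≟-move forward = yes refl
forward ≟-move backward = no λ ()
backward ≟-move spoke = no λ ()
backward ≟-move forward = no λ ()
backward ≟-move backward = yes refl

_≟-label_ : DecidableEquality Label
_≟-label_ = ≡-dec _≟-side_ (≡-dec Fin._≟_ Fin._≟_)

open DecMembership _≟-label_ using (_∈?_)

∀-move? : {P : Move → Set} → (∀ t → Dec (P t)) → Dec (∀ t → P t)
∀-move? P? = map′ (λ { (s , _ , _) spoke → s ; (_ , f , _) forward → f ; (_ , _ , b) backward → b })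
  (λ f → f spoke , f forward , f backward) (P? spoke ×-dec P? forward ×-dec P? backward)

∀-side? : {P : Side → Set} → (∀ side → Dec (P side)) → Dec (∀ side → P side)
∀-side? P? = map′ (λ { (o , _) outer → o ; (_ , i) inner → i }) (λ f → f outer , f inner)
  (P? outer ×-dec P? inner)

∀-label? : {P : Label → Set} → (∀ l → Dec (P l)) → Dec (∀ l → P l)
∀-label? P? = map′ (λ f (side , s , ρ) → f side s ρ) (λ f side s ρ → f (side , s , ρ))
  (∀-side? λ side → Fin.all? λ s → Fin.all? λ ρ → P? (side , s , ρ))

open StarModel step back colour

isStarModel : IsStarModel
isStarModel = record
  { back-converse = toWitness {a? = ∀-label? λ l → ∀-move? λ t →
      All.all? (λ l′ → l ∈? step l′ (back l′ t)) (step l t)} _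
  ; colour-symmetric = toWitness {a? = ∀-label? λ l → ∀-move? λ t →
      All.all? (λ l′ → colour l t l′ Fin.≟ colour l′ (back l′ t) l) (step l t)} _
  ; moves-distinctly-coloured = toWitness {a? = ∀-label? λ l → ∀-move? λ t → ∀-move? λ t′ →
      ¬? (t ≟-move t′) →-dec
      All.all? (λ l₁ → All.all? (λ l₂ → ¬? (colour l t l₁ Fin.≟ colour l t′ l₂)) (step l t′)) (step l t)} _
  ; no-alternating-walk = toWitness {a? =
      ∀-label? λ l₀ → ∀-move? λ t₁ → All.all? (λ l₁ →
      ∀-move? λ t₂ → ¬? (t₂ ≟-move back l₁ t₁) →-dec All.all? (λ l₂ →
      ∀-move? λ t₃ → ¬? (t₃ ≟-move back l₂ t₂) →-dec All.all? (λ l₃ →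
      colour l₀ t₁ l₁ Fin.≟ colour l₂ t₃ l₃ →-dec
      ∀-move? λ t₄ → ¬? (t₄ ≟-move back l₃ t₃) →-dec All.all? (λ l₄ →
      ¬? (colour l₁ t₂ l₂ Fin.≟ colour l₃ t₄ l₄)) (step l₃ t₄)) (step l₂ t₃)) (step l₁ t₂)) (step l₀ t₁)} _
  }

middleRow lastRow : ℕ → Row
middleRow 0 = mid₀
middleRow 1 = mid₁
middleRow 2 = mid₂
middleRow (suc (suc (suc r))) = middleRow r
lastRow 0 = last₀
lastRow 1 = last₁
lastRow 2 = last₂
lastRow (suc (suc (suc r))) = lastRow r

row : ℕ → ℕ → Row
row d zero = first
row d (suc r) = if does (suc (suc r) ≟ d) then lastRow (suc r) else middleRow (suc r)

middleRow-next : ∀ s r → (outer , s , middleRow (suc r)) ∈ outerNext s (middleRow r)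
middleRow-next s 0 = here refl
middleRow-next s 1 = here refl
middleRow-next s 2 = here refl
middleRow-next s (suc (suc (suc r))) = middleRow-next s r

lastRow-next : ∀ s r → (outer , s , lastRow (suc r)) ∈ outerNext s (middleRow r)
lastRow-next s 0 = there (here refl)
lastRow-next s 1 = there (here refl)
lastRow-next s 2 = there (here refl)
lastRow-next s (suc (suc (suc r))) = lastRow-next s r

outerNext-lastRow : ∀ s r → outerNext s (lastRow r) ≡ map (λ s′ → outer , s′ , first) (wrapNext s)
outerNext-lastRow s 0 = refl
outerNext-lastRow s 1 = refl
outerNext-lastRow s 2 = refl
outerNext-lastRow s (suc (suc (suc r))) = outerNext-lastRow s r

row-middle : ∀ {d r} → suc (suc r) ≢ d → row d (suc r) ≡ middleRow (suc r)
row-middle {d} {r} ne =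
  cong (if_then lastRow (suc r) else middleRow (suc r)) (dec-false (suc (suc r) ≟ d) ne)

row-last : ∀ {d r} → suc (suc r) ≡ d → row d (suc r) ≡ lastRow (suc r)
row-last {d} {r} eq =
  cong (if_then lastRow (suc r) else middleRow (suc r)) (dec-true (suc (suc r) ≟ d) eq)

row-next : ∀ {d r} s → 3 ≤ d → suc r < d → (outer , s , row d (suc r)) ∈ outerNext s (row d r)
row-next {d} {zero} s 3≤d _ = subst (λ ρ → (outer , s , ρ) ∈ outerNext s first)
  (sym (row-middle {d} {0} λ { refl → contradiction 3≤d λ { (s≤s (s≤s ())) } })) (here refl)
row-next {d} {suc r} s _ 2+r<d
  rewrite row-middle {d} {r} (λ { refl → n≮n _ 2+r<d }) with suc (suc (suc r)) ≟ d
... | yes last = subst (λ ρ → (outer , s , ρ) ∈ outerNext s (middleRow (suc r)))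
                     (sym (row-last {d} {suc r} last)) (lastRow-next s (suc r))
... | no ¬last = subst (λ ρ → (outer , s , ρ) ∈ outerNext s (middleRow (suc r)))
                       (sym (row-middle {d} {suc r} ¬last)) (middleRow-next s (suc r))

row-wrap : ∀ {d r s s′} → 3 ≤ d → suc r ≡ d → s′ ∈ wrapNext s →
  (outer , s′ , row d 0) ∈ outerNext s (row d r)
row-wrap {r = zero} 3≤d refl _ = contradiction 3≤d λ { (s≤s ()) }
row-wrap {d} {suc r} {s} _ last s′∈ rewrite row-last {d} {r} last | outerNext-lastRow s (suc r) =
  ∈-map⁺ _ s′∈

blockLength : ℕ → ℕ → ℕ
blockLength (suc a) b = 3 + blockLength a b
blockLength zero (suc b) = 4 + blockLength zero b
blockLength zero zero = 0

blockState : ℕ → ℕ → ℕ → State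
blockState (suc a) b 0 = x₀
blockState (suc a) b 1 = x₁
blockState (suc a) b 2 = x₂
blockState (suc a) b (suc (suc (suc p))) = blockState a b p
blockState zero (suc b) 0 = y₀
blockState zero (suc b) 1 = y₁
blockState zero (suc b) 2 = y₂
blockState zero (suc b) 3 = y₃
blockState zero (suc b) (suc (suc (suc (suc p)))) = blockState zero b p
blockState zero zero _ = x₀  -- only reached beyond position blockLength a b

all-blockStates⇒blockState : ∀ {P : State → Set} → All P blockStates → ∀ a b p → P (blockState a b p)
all-blockStates⇒blockState (h ∷ _) (suc a) b 0 = h
all-blockStates⇒blockState (_ ∷ h ∷ _) (suc a) b 1 = h
all-blockStates⇒blockState (_ ∷ _ ∷ h ∷ _) (suc a) b 2 = h
all-blockStates⇒blockState hs (suc a) b (suc (suc (suc p))) = all-blockStates⇒blockState hs a b p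
all-blockStates⇒blockState (_ ∷ _ ∷ _ ∷ h ∷ _) zero (suc b) 0 = h
all-blockStates⇒blockState (_ ∷ _ ∷ _ ∷ _ ∷ h ∷ _) zero (suc b) 1 = h
all-blockStates⇒blockState (_ ∷ _ ∷ _ ∷ _ ∷ _ ∷ h ∷ _) zero (suc b) 2 = h
all-blockStates⇒blockState (_ ∷ _ ∷ _ ∷ _ ∷ _ ∷ _ ∷ h ∷ _) zero (suc b) 3 = h
all-blockStates⇒blockState hs zero (suc b) (suc (suc (suc (suc p)))) =
  all-blockStates⇒blockState hs zero b p
all-blockStates⇒blockState (h ∷ _) zero zero _ = h

blockState∈blockStates : ∀ a b p → blockState a b p ∈ blockStates
blockState∈blockStates = all-blockStates⇒blockState (All.tabulate id)

blockState-start : ∀ a b → 0 < blockLength a b → blockState a b 0 ∈ blockStarts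
blockState-start (suc a) b _ = here refl
blockState-start zero (suc b) _ = there (here refl)

blockState-next : ∀ a b p → suc p < blockLength a b → blockState a b (suc p) ∈ innerNext (blockState a b p)
blockState-next (suc a) b 0 _ = here refl
blockState-next (suc a) b 1 _ = here refl
blockState-next (suc a) b 2 (s≤s (s≤s (s≤s 0<L))) = blockState-start a b 0<L
blockState-next (suc a) b (suc (suc (suc p))) (s≤s (s≤s (s≤s lt))) = blockState-next a b p lt
blockState-next zero (suc b) 0 _ = here refl
blockState-next zero (suc b) 1 _ = here refl
blockState-next zero (suc b) 2 _ = here refl
blockState-next zero (suc b) 3 (s≤s (s≤s (s≤s (s≤s 0<L)))) = blockState-start zero b 0<L
blockState-next zero (suc b) (suc (suc (suc (suc p)))) (s≤s (s≤s (s≤s (s≤s lt)))) =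
  blockState-next zero b p lt

blockState-end : ∀ a b p → suc p ≡ blockLength a b → innerNext (blockState a b p) ≡ blockStarts
blockState-end (suc a) b 2 _ = refl
blockState-end (suc a) b (suc (suc (suc p))) eq = blockState-end a b p (cong (_∸ 3) eq)
blockState-end zero (suc b) 3 _ = refl
blockState-end zero (suc b) (suc (suc (suc (suc p)))) eq = blockState-end zero b p (cong (_∸ 4) eq)

blockLength≢2 : ∀ a b → blockLength a b ≢ 2
blockLength≢2 (suc a) b ()
blockLength≢2 zero (suc b) ()
blockLength≢2 zero zero ()

blockDecomposition : ∀ N → 3 ≤ N → N ≢ 5 → ∃₂ λ a b → blockLength a b ≡ N
blockDecomposition 1 (s≤s ()) _
blockDecomposition 2 (s≤s (s≤s ())) _
blockDecomposition 3 _ _ = 1 , 0 , refl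
blockDecomposition 4 _ _ = 0 , 1 , refl
blockDecomposition 5 _ N≢5 = contradiction refl N≢5
blockDecomposition 6 _ _ = 2 , 0 , refl
blockDecomposition 7 _ _ = 1 , 1 , refl
blockDecomposition 8 _ _ = 0 , 2 , refl
blockDecomposition (suc (suc (suc N@(suc (suc (suc (suc (suc (suc _))))))))) _ _ =
  let a , b , eq = blockDecomposition N (s≤s (s≤s (s≤s z≤n))) (λ ()) in suc a , b , cong (3 +_) eq

pentagonState₁ pentagonState₃ : ℕ → State
pentagonState₁ 0 = p₀
pentagonState₁ 1 = p₁
pentagonState₁ 2 = p₂
pentagonState₁ 3 = p₃
pentagonState₁ _ = p₄
pentagonState₃ 0 = q₀
pentagonState₃ 1 = q₁
pentagonState₃ 2 = q₂
pentagonState₃ 3 = q₃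
pentagonState₃ _ = q₄

data CyclePattern : ℕ → ℕ → Set where
  pair : ∀ {t} → CyclePattern 2 t
  blocks : ∀ a b {t} → CyclePattern (blockLength a b) t
  pentagon₁ : ∀ {t} → t % 5 ≡ 1 → CyclePattern 5 t
  pentagon₃ : ∀ {t} → t % 5 ≡ 3 → CyclePattern 5 t

cycleState : ∀ {N t} → CyclePattern N t → ℕ → State
cycleState pair zero = a₀
cycleState pair (suc _) = a₁
cycleState (blocks a b) = blockState a b
cycleState (pentagon₁ _) = pentagonState₁
cycleState (pentagon₃ _) = pentagonState₃

cases<5 : ∀ {P : ℕ → Set} → P 0 → P 1 → P 2 → P 3 → P 4 → ∀ p → p < 5 → P p
cases<5 h₀ _ _ _ _ 0 _ = h₀
cases<5 _ h₁ _ _ _ 1 _ = h₁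
cases<5 _ _ h₂ _ _ 2 _ = h₂
cases<5 _ _ _ h₃ _ 3 _ = h₃
cases<5 _ _ _ _ h₄ 4 _ = h₄
cases<5 _ _ _ _ _ (suc (suc (suc (suc (suc _))))) (s≤s (s≤s (s≤s (s≤s (s≤s ())))))

cycleState-next : ∀ {N t} .{{_ : NonZero N}} (P : CyclePattern N t) {p} → p < N →
  cycleState P ((p + 1) % N) ∈ innerNext (cycleState P p)
cycleState-next pair {0} _ = here refl
cycleState-next pair {1} _ = here refl
cycleState-next pair {suc (suc _)} (s≤s (s≤s ()))
cycleState-next (blocks a b) {p} p<N rewrite +-comm p 1 with suc p <? blockLength a b
... | yes 1+p<N rewrite m<n⇒m%n≡m 1+p<N = blockState-next a b p 1+p<N
... | no 1+p≮N with ≤-antisym p<N (≮⇒≥ 1+p≮N)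
...   | end rewrite blockState-end a b p end | trans (cong (_% blockLength a b) end) (n%n≡0 _) =
  blockState-start a b (≤-trans (s≤s z≤n) p<N)
cycleState-next (pentagon₁ _) {p} =
  cases<5 {λ p → pentagonState₁ ((p + 1) % 5) ∈ innerNext (pentagonState₁ p)}
    (here refl) (here refl) (here refl) (here refl) (here refl) p
cycleState-next (pentagon₃ _) {p} =
  cases<5 {λ p → pentagonState₃ ((p + 1) % 5) ∈ innerNext (pentagonState₃ p)}
    (here refl) (here refl) (here refl) (here refl) (here refl) p

pairState∈pairStates : ∀ {t} q → cycleState {t = t} pair q ∈ pairStates
pairState∈pairStates zero = here refl
pairState∈pairStates (suc _) = there (here refl)

cycleState-wrap : ∀ {N t} .{{_ : NonZero N}} (P : CyclePattern N t) {p} → p < N →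
  cycleState P ((p + t) % N) ∈ wrapNext (cycleState P p)
cycleState-wrap (pair {t}) {0} _ = pairState∈pairStates ((0 + t) % 2)
cycleState-wrap (pair {t}) {suc p} _ = pairState∈pairStates ((suc p + t) % 2)
cycleState-wrap (blocks a b {t}) {p} _ =
  all-blockStates⇒blockState {λ s → blockState a b q ∈ wrapNext s} (m ∷ m ∷ m ∷ m ∷ m ∷ m ∷ m ∷ []) a b p
  where
  q = (p + t) % blockLength a b
  m = blockState∈blockStates a b q
cycleState-wrap (pentagon₁ {t} t%5≡1) {p} p<5 rewrite sym ([m+n%o]%o≡[m+n]%o p t 5) | t%5≡1 =
  cases<5 {λ p → pentagonState₁ ((p + 1) % 5) ∈ wrapNext (pentagonState₁ p)}
    (here refl) (here refl) (here refl) (here refl) (here refl) p p<5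
cycleState-wrap (pentagon₃ {t} t%5≡3) {p} p<5 rewrite sym ([m+n%o]%o≡[m+n]%o p t 5) | t%5≡3 =
  cases<5 {λ p → pentagonState₃ ((p + 3) % 5) ∈ wrapNext (pentagonState₃ p)}
    (here refl) (here refl) (here refl) (here refl) (here refl) p p<5

cycleState-paired : ∀ {N t} (P : CyclePattern N t) p → paired (cycleState P p) ≡ does (N ≟ 2)
cycleState-paired pair zero = refl
cycleState-paired pair (suc _) = refl
cycleState-paired (blocks a b) p = trans
  (all-blockStates⇒blockState {λ s → paired s ≡ false}
    (refl ∷ refl ∷ refl ∷ refl ∷ refl ∷ refl ∷ refl ∷ []) a b p)
  (sym (dec-false (blockLength a b ≟ 2) (blockLength≢2 a b)))
cycleState-paired (pentagon₁ _) 0 = refl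
cycleState-paired (pentagon₁ _) 1 = refl
cycleState-paired (pentagon₁ _) 2 = refl
cycleState-paired (pentagon₁ _) 3 = refl
cycleState-paired (pentagon₁ _) (suc (suc (suc (suc _)))) = refl
cycleState-paired (pentagon₃ _) 0 = refl
cycleState-paired (pentagon₃ _) 1 = refl
cycleState-paired (pentagon₃ _) 2 = refl
cycleState-paired (pentagon₃ _) 3 = refl
cycleState-paired (pentagon₃ _) (suc (suc (suc (suc _)))) = refl

pentagonPattern : ∀ {K t} → 1 ≤ K → 2 * K ≤ 5 → K * t % 5 ≡ 1 → CyclePattern 5 t
pentagonPattern {1} {t} _ _ Kt≡1 = pentagon₁ (trans (cong (_% 5) (sym (+-identityʳ t))) Kt≡1)
pentagonPattern {2} {t} _ _ Kt≡1 = pentagon₃ (cases<5 {λ r → 2 * r % 5 ≡ 1 → r ≡ 3}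
  (λ ()) (λ ()) (λ ()) (λ _ → refl) (λ ()) (t % 5) (m%n<n t 5) (trans (sym (%-distribˡ-* 2 t 5)) Kt≡1))
pentagonPattern {suc (suc (suc K))} _ 2K≤5 _ =
  contradiction (≤-trans (*-monoʳ-≤ 2 (m≤m+n 3 K)) 2K≤5) λ { (s≤s (s≤s (s≤s (s≤s (s≤s ()))))) }

cyclePattern : ∀ {N K t} .{{_ : NonZero N}} →
  2 ≤ N → 1 ≤ K → 2 * K ≤ N → K * t % N ≡ 1 → CyclePattern N t
cyclePattern {N} {t = t} 2≤N 1≤K 2K≤N Kt≡1 with N ≟ 2 | N ≟ 5
... | yes refl | _ = pair
... | no _ | yes refl = pentagonPattern 1≤K 2K≤N Kt≡1
... | no N≢2 | no N≢5 =
  let a , b , eq = blockDecomposition N (≤∧≢⇒< 2≤N (λ e → N≢2 (sym e))) N≢5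
  in subst (λ N → CyclePattern N t) eq (blocks a b)

-- The generalized Petersen graph GP(N d, K d)

module Circulant (n : ℕ) .{{_ : NonZero n}} where

  Adjacent : ℕ → Fin n → Fin n → Set
  Adjacent s i j = (j ≡ i + s mod n) ⊎ (i ≡ j + s mod n)

  direction : ℕ → Fin n → Fin n → Move
  direction s i j = if does (toℕ j ≟ (toℕ i + s) % n) then forward else backward

  direction-forward : ∀ s i j → j ≡ i + s mod n → direction s i j ≡ forward
  direction-forward s i j e =
    cong (if_then forward else backward) (dec-true (toℕ j ≟ (toℕ i + s) % n) e)

  direction-backward : ∀ s i j → ¬ (j ≡ i + s mod n) → direction s i j ≡ backward
  direction-backward s i j ¬e =
    cong (if_then forward else backward) (dec-false (toℕ j ≟ (toℕ i + s) % n) ¬e)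

  adjacent-backward : ∀ s i j → Adjacent s i j → ¬ (j ≡ i + s mod n) → i ≡ j + s mod n
  adjacent-backward _ _ _ (inj₁ e) ¬e = contradiction e ¬e
  adjacent-backward _ _ _ (inj₂ e) _ = e

  direction≢spoke : ∀ s i j → direction s i j ≢ spoke
  direction≢spoke s i j eq with toℕ j ≟ (toℕ i + s) % n
  ... | yes e = contradiction (trans (sym (direction-forward s i j e)) eq) λ ()
  ... | no ¬e = contradiction (trans (sym (direction-backward s i j ¬e)) eq) λ ()

  direction-injective : ∀ s i j j′ → Adjacent s i j → Adjacent s i j′ →
    direction s i j ≡ direction s i j′ → j ≡ j′
  direction-injective s i j j′ a a′ eq
    with toℕ j ≟ (toℕ i + s) % n | toℕ j′ ≟ (toℕ i + s) % n
  ... | yes e | yes e′ = Fin.toℕ-injective (trans e (sym e′))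
  ... | no ¬e | no ¬e′ = Fin.toℕ-injective (%-cancelʳ-+ s n (Fin.toℕ<n j) (Fin.toℕ<n j′)
          (trans (sym (adjacent-backward s i j a ¬e)) (adjacent-backward s i j′ a′ ¬e′)))
  ... | yes e | no ¬e′ = contradiction
          (trans (sym (direction-forward s i j e)) (trans eq (direction-backward s i j′ ¬e′))) λ ()
  ... | no ¬e | yes e′ = contradiction
          (trans (sym (direction-backward s i j ¬e)) (trans eq (direction-forward s i j′ e′))) λ ()

  shift-twice : ∀ s i j → j ≡ i + s mod n → i ≡ j + s mod n ⇔ (s + s) % n ≡ 0
  shift-twice s i j e =
    subst (λ m → toℕ i ≡ m ⇔ (s + s) % n ≡ 0) (sym twice) (a≡[a+m]%n⇔m%n≡0 (s + s) n (Fin.toℕ<n i))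
    where
    twice : (toℕ j + s) % n ≡ (toℕ i + (s + s)) % n
    twice = begin
      (toℕ j + s) % n              ≡⟨ cong (λ m → (m + s) % n) e ⟩
      ((toℕ i + s) % n + s) % n    ≡⟨ [m%o+n]%o≡[m+n]%o (toℕ i + s) s n ⟩
      (toℕ i + s + s) % n          ≡⟨ cong (_% n) (+-assoc (toℕ i) s s) ⟩
      (toℕ i + (s + s)) % n        ∎

  direction-reverse : ∀ s i j → Adjacent s i j →
    direction s j i ≡ reverse (does ((s + s) % n ≟ 0)) (direction s i j)
  direction-reverse s i j a with toℕ j ≟ (toℕ i + s) % n
  ... | yes e = trans
    (cong (if_then forward else backward)
      (does-⇔ (shift-twice s i j e) (toℕ i ≟ (toℕ j + s) % n) ((s + s) % n ≟ 0)))
    (cong (reverse _) (sym (direction-forward s i j e)))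
  ... | no ¬e = trans (direction-forward s j i (adjacent-backward s i j a ¬e))
                      (cong (reverse _) (sym (direction-backward s i j ¬e)))

module GeneralizedPetersen {N d K K⁻¹ : ℕ} .{{_ : NonZero N}} .{{_ : NonZero d}}
  (3≤d : 3 ≤ d) (1≤K : 1 ≤ K) (2K≤N : 2 * K ≤ N) (coprime : Coprime N K)
  (inverse : K * K⁻¹ % N ≡ 1) (P : CyclePattern N K⁻¹) where

  n k : ℕ
  n = N * d
  k = K * d

  instance
    n≢0 : NonZero n
    n≢0 = m*n≢0 N d

  open Circulant n

  position : ℕ → ℕ
  position a = a / d * K⁻¹ % N

  tag : ℕ → State × Row
  tag a = cycleState P (position a) , row d (a % d)

  tag-% : ∀ a → tag (a % n) ≡ tag a
  tag-% a = cong₂ (λ p r → cycleState P p , row d r) position-% (m∣n⇒o%n%m≡o%m d n a (n∣m*n N))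
    where
    position-% : position (a % n) ≡ position a
    position-% = begin
      a % n / d * K⁻¹ % N   ≡⟨ cong (λ q → q * K⁻¹ % N) (m%[n*o]/o≡m/o%n a N d) ⟩
      a / d % N * K⁻¹ % N   ≡⟨ [m%o*n]%o≡[m*n]%o (a / d) K⁻¹ N ⟩
      a / d * K⁻¹ % N       ∎

  tag-+k : ∀ a → tag (a + k) ≡ (cycleState P ((position a + 1) % N) , row d (a % d))
  tag-+k a = cong₂ (λ p r → cycleState P p , row d r) position-+k ([m+kn]%n≡m%n a K d)
    where
    position-+k : position (a + k) ≡ (position a + 1) % N
    position-+k = begin
      (a + K * d) / d * K⁻¹ % N          ≡⟨ cong (λ q → q * K⁻¹ % N) (+-distrib-/-∣ʳ a (divides-refl K)) ⟩
      (a / d + K * d / d) * K⁻¹ % N      ≡⟨ cong (λ q → (a / d + q) * K⁻¹ % N) (m*n/n≡m K d) ⟩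
      (a / d + K) * K⁻¹ % N              ≡⟨ cong (_% N) (*-distribʳ-+ K⁻¹ (a / d) K) ⟩
      (a / d * K⁻¹ + K * K⁻¹) % N        ≡⟨ [m+n%o]%o≡[m+n]%o (a / d * K⁻¹) (K * K⁻¹) N ⟨
      (a / d * K⁻¹ + K * K⁻¹ % N) % N    ≡⟨ cong (λ m → (a / d * K⁻¹ + m) % N) inverse ⟩
      (a / d * K⁻¹ + 1) % N              ≡⟨ [m%o+n]%o≡[m+n]%o (a / d * K⁻¹) 1 N ⟨
      (position a + 1) % N               ∎

  tag-suc-within : ∀ a → suc (a % d) < d →
    tag (suc a) ≡ (cycleState P (position a) , row d (suc (a % d)))
  tag-suc-within a within = cong₂ (λ p r → cycleState P p , row d r)
    (cong (λ q → q * K⁻¹ % N) (trans ([1+m]/n≡[1+m%n]/n+m/n a d) (cong (_+ a / d) (m<n⇒m/n≡0 within))))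
    (trans ([1+m]%n≡[1+m%n]%n a d) (m<n⇒m%n≡m within))

  tag-suc-wrap : ∀ a → suc (a % d) ≡ d →
    tag (suc a) ≡ (cycleState P ((position a + K⁻¹) % N) , first)
  tag-suc-wrap a wraps = cong₂ (λ p r → cycleState P p , row d r) position-suc
    (trans ([1+m]%n≡[1+m%n]%n a d) (trans (cong (_% d) wraps) (n%n≡0 d)))
    where
    position-suc : position (suc a) ≡ (position a + K⁻¹) % N
    position-suc = begin
      suc a / d * K⁻¹ % N                  ≡⟨ cong (λ q → q * K⁻¹ % N) ([1+m]/n≡[1+m%n]/n+m/n a d) ⟩
      (suc (a % d) / d + a / d) * K⁻¹ % N  ≡⟨ cong (λ q → (q / d + a / d) * K⁻¹ % N) wraps ⟩
      (d / d + a / d) * K⁻¹ % N            ≡⟨ cong (λ q → (q + a / d) * K⁻¹ % N) (n/n≡1 d) ⟩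
      (K⁻¹ + a / d * K⁻¹) % N              ≡⟨ cong (_% N) (+-comm K⁻¹ (a / d * K⁻¹)) ⟩
      (a / d * K⁻¹ + K⁻¹) % N              ≡⟨ [m%o+n]%o≡[m+n]%o (a / d * K⁻¹) K⁻¹ N ⟨
      (position a + K⁻¹) % N               ∎

  outer-step : ∀ a → (outer , tag (suc a)) ∈ step (outer , tag a) forward
  outer-step a with suc (a % d) <? d
  ... | yes within = subst (λ τ → (outer , τ) ∈ step (outer , tag a) forward)
    (sym (tag-suc-within a within)) (row-next _ 3≤d within)
  ... | no ¬within = subst (λ τ → (outer , τ) ∈ step (outer , tag a) forward)
    (sym (tag-suc-wrap a wraps)) (row-wrap 3≤d wraps (cycleState-wrap P (m%n<n _ N)))
    where wraps = ≤-antisym (m%n<n a d) (≮⇒≥ ¬within)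

  inner-step : ∀ a → (inner , tag (a + k)) ∈ step (inner , tag a) forward
  inner-step a = subst (λ τ → (inner , τ) ∈ step (inner , tag a) forward) (sym (tag-+k a))
                   (∈-map⁺ _ (cycleState-next P (m%n<n _ N)))

  label : GPVertex n → Label
  label (u i) = outer , tag (toℕ i)
  label (v i) = inner , tag (toℕ i)

  move : GPVertex n → GPVertex n → Move
  move (u i) (u j) = direction 1 i j
  move (v i) (v j) = direction k i j
  move (u _) (v _) = spoke
  move (v _) (u _) = spoke

  outer-forward : ∀ i j → j ≡ i + 1 mod n → label (u j) ∈ step (label (u i)) (move (u i) (u j))
  outer-forward i j e = subst₂ (λ τ t → (outer , τ) ∈ step (label (u i)) t)
    (sym (trans (cong tag e) (trans (tag-% (toℕ i + 1)) (cong tag (+-comm (toℕ i) 1)))))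
    (sym (direction-forward 1 i j e)) (outer-step (toℕ i))

  inner-forward : ∀ i j → j ≡ i + k mod n → label (v j) ∈ step (label (v i)) (move (v i) (v j))
  inner-forward i j e = subst₂ (λ τ t → (inner , τ) ∈ step (label (v i)) t)
    (sym (trans (cong tag e) (tag-% (toℕ i + k))))
    (sym (direction-forward k i j e)) (inner-step (toℕ i))

  covered : ∀ {x y} → GPAdj n k x y →
    label y ∈ step (label x) (move x y) ⊎ label x ∈ step (label y) (move y x)
  covered {u i} {u j} (inj₁ e) = inj₁ (outer-forward i j e)
  covered {u i} {u j} (inj₂ e) = inj₂ (outer-forward j i e)
  covered {v i} {v j} (inj₁ e) = inj₁ (inner-forward i j e)
  covered {v i} {v j} (inj₂ e) = inj₂ (inner-forward j i e)
  covered {u i} {v j} refl = inj₁ (here refl)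
  covered {v i} {u j} refl = inj₁ (here refl)

  adj-sym : ∀ {x y} → GPAdj n k x y → GPAdj n k y x
  adj-sym {u _} {u _} (inj₁ e) = inj₂ e
  adj-sym {u _} {u _} (inj₂ e) = inj₁ e
  adj-sym {v _} {v _} (inj₁ e) = inj₂ e
  adj-sym {v _} {v _} (inj₂ e) = inj₁ e
  adj-sym {u _} {v _} e = sym e
  adj-sym {v _} {u _} e = sym e

  move-injective : ∀ {x y z} → GPAdj n k x y → GPAdj n k x z → move x y ≡ move x z → y ≡ z
  move-injective {u i} {u j} {u j′} a a′ e = cong u (direction-injective 1 i j j′ a a′ e)
  move-injective {v i} {v j} {v j′} a a′ e = cong v (direction-injective k i j j′ a a′ e)
  move-injective {u i} {u j} {v _} _ _ e = contradiction e (direction≢spoke 1 i j)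
  move-injective {v i} {v j} {u _} _ _ e = contradiction e (direction≢spoke k i j)
  move-injective {u i} {v _} {u j′} _ _ e = contradiction (sym e) (direction≢spoke 1 i j′)
  move-injective {v i} {u _} {v j′} _ _ e = contradiction (sym e) (direction≢spoke k i j′)
  move-injective {u _} {v _} {v _} refl refl _ = refl
  move-injective {v _} {u _} {u _} refl refl _ = refl

  2%n≢0 : (1 + 1) % n ≢ 0
  2%n≢0 eq = contradiction (trans (sym (m<n⇒m%n≡m 2<n)) eq) λ ()
    where 2<n = <-≤-trans (s≤s (s≤s (s≤s z≤n))) (≤-trans 3≤d (m≤n*m d N))

  k+k≡2K*d : k + k ≡ 2 * K * d
  k+k≡2K*d = begin
    K * d + K * d   ≡⟨ *-distribʳ-+ d K K ⟨
    (K + K) * d     ≡⟨ cong (λ m → (K + m) * d) (+-identityʳ K) ⟨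
    2 * K * d       ∎

  N≡2⇔k+k≡0 : N ≡ 2 ⇔ (k + k) % n ≡ 0
  N≡2⇔k+k≡0 = mk⇔ from to
    where
    to : (k + k) % n ≡ 0 → N ≡ 2
    to eq = trans (sym 2K≡N) (cong (2 *_) K≡1)
      where
      2K%N≡0 : 2 * K % N ≡ 0
      2K%N≡0 = m*n≡0⇒m≡0 (2 * K % N) d (begin
        2 * K % N * d     ≡⟨ m%n*o≡m*o%[n*o] (2 * K) N d ⟩
        2 * K * d % n     ≡⟨ cong (_% n) k+k≡2K*d ⟨
        (k + k) % n       ≡⟨ eq ⟩
        0                 ∎)
      2K≡N : 2 * K ≡ N
      2K≡N = ≤-antisym 2K≤N (≮⇒≥ λ 2K<N → contradiction (trans (sym (m<n⇒m%n≡m 2K<N)) 2K%N≡0)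
                                  (m<n⇒n≢0 (*-monoʳ-≤ 2 1≤K)))
      K≡1 : K ≡ 1
      K≡1 = coprime (divides 2 (sym 2K≡N) , ∣-refl)
    from : N ≡ 2 → (k + k) % n ≡ 0
    from N≡2 = begin
      (k + k) % n       ≡⟨ cong (_% n) k+k≡2K*d ⟩
      2 * K * d % n     ≡⟨ cong (λ m → m * d % n) 2K≡N ⟩
      n % n             ≡⟨ n%n≡0 n ⟩
      0                 ∎
      where
      K≡1 : K ≡ 1
      K≡1 = ≤-antisym (*-cancelˡ-≤ 2 (≤-trans 2K≤N (≤-reflexive N≡2))) 1≤K
      2K≡N : 2 * K ≡ N
      2K≡N = trans (cong (2 *_) K≡1) (sym N≡2)

  move-back : ∀ {x y} → GPAdj n k x y → move y x ≡ back (label y) (move x y)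
  move-back {u i} {u j} a = trans (direction-reverse 1 i j a)
    (cong (λ b → reverse b (direction 1 i j)) (dec-false ((1 + 1) % n ≟ 0) 2%n≢0))
  move-back {v i} {v j} a = trans (direction-reverse k i j a)
    (cong (λ b → reverse b (direction k i j)) (sym paired-j))
    where
    paired-j : paired (cycleState P (position (toℕ j))) ≡ does ((k + k) % n ≟ 0)
    paired-j = trans (cycleState-paired P _) (does-⇔ N≡2⇔k+k≡0 (N ≟ 2) ((k + k) % n ≟ 0))
  move-back {u _} {v _} _ = refl
  move-back {v _} {u _} _ = refl

  cover : Cover (GPAdj n k)
  cover = record
    { label = label ; move = move ; adj-sym = adj-sym
    ; move-injective = move-injective ; move-back = move-back ; covered = covered }

  star : StarChromaticIndex≤ (GPAdj n k) 5
  star = Cover.colouring cover , Lift.isStarEdgeColoring isStarModel cover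

modular-inverse : ∀ {N K} .{{_ : NonZero N}} → 2 ≤ N → Coprime N K → ∃ λ K⁻¹ → K * K⁻¹ % N ≡ 1
modular-inverse {N@(suc N′)} {K} 2≤N coprime with coprime-Bézout coprime
... | Bézout.-+ x y eq = y , (begin
  K * y % N          ≡⟨ cong (_% N) (*-comm K y) ⟩
  y * K % N          ≡⟨ cong (_% N) eq ⟨
  (1 + x * N) % N    ≡⟨ [m+kn]%n≡m%n 1 x N ⟩
  1 % N              ≡⟨ m<n⇒m%n≡m 2≤N ⟩
  1                  ∎)
... | Bézout.+- x y eq = y * N′ , (begin
  K * (y * N′) % N                  ≡⟨ [m+kn]%n≡m%n (K * (y * N′)) x N ⟨
  (K * (y * N′) + x * N) % N        ≡⟨ cong (λ m → (K * (y * N′) + m) % N) eq ⟨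
  (K * (y * N′) + (1 + y * K)) % N  ≡⟨ cong (_% N) (rearrange K y N′) ⟩
  (1 + y * K * N) % N               ≡⟨ [m+kn]%n≡m%n 1 (y * K) N ⟩
  1 % N                             ≡⟨ m<n⇒m%n≡m 2≤N ⟩
  1                                 ∎)
  where
  open +-*-Solver
  rearrange : ∀ K y N′ → K * (y * N′) + (1 + y * K) ≡ 1 + y * K * suc N′
  rearrange = solve 3
    (λ K y N′ → K :* (y :* N′) :+ (con 1 :+ y :* K) := con 1 :+ y :* K :* (con 1 :+ N′)) refl

gp-star : ∀ {N d K} .{{_ : NonZero N}} .{{_ : NonZero d}} →
  3 ≤ d → 1 ≤ K → 2 * K ≤ N → Coprime N K →
  StarChromaticIndex≤ (GPAdj (N * d) (K * d) {{m*n≢0 N d}}) 5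
gp-star 3≤d 1≤K 2K≤N coprime =
  let 2≤N = ≤-trans (*-monoʳ-≤ 2 1≤K) 2K≤N
      K⁻¹ , inverse = modular-inverse 2≤N coprime
  in GeneralizedPetersen.star 3≤d 1≤K 2K≤N coprime inverse (cyclePattern 2≤N 1≤K 2K≤N inverse)

theorem1 : (n k : ℕ) → .{{_ : NonZero n}} → 1 ≤ k → 2 * k ≤ n → 3 ≤ gcd n k →
    StarChromaticIndex≤ (GPAdj n k) 5
theorem1 n k 1≤k 2k≤n 3≤d =
  subst₂ (λ n k → .{{_ : NonZero n}} → StarChromaticIndex≤ (GPAdj n k) 5) N*d≡n K*d≡k
    (gp-star 3≤d 1≤K 2K≤N (coprime-/gcd n k))
  where
  d = gcd n k
  instance
    d≢0 : NonZero d
    d≢0 = >-nonZero (<-≤-trans (s≤s z≤n) 3≤d)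
  N = n / d
  K = k / d
  N*d≡n : N * d ≡ n
  N*d≡n = m/n*n≡m (gcd[m,n]∣m n k)
  K*d≡k : K * d ≡ k
  K*d≡k = m/n*n≡m (gcd[m,n]∣n n k)
  1≤K : 1 ≤ K
  1≤K = m≥n⇒m/n>0 (∣⇒≤ {{>-nonZero 1≤k}} (gcd[m,n]∣n n k))
  2K≤N : 2 * K ≤ N
  2K≤N = *-cancelʳ-≤ (2 * K) N d
    (subst₂ _≤_ (trans (cong (2 *_) (sym K*d≡k)) (sym (*-assoc 2 K d))) (sym N*d≡n) 2k≤n)
  2≤N : 2 ≤ N
  2≤N = ≤-trans (*-monoʳ-≤ 2 1≤K) 2K≤N
  instance
    N≢0 : NonZero N
    N≢0 = >-nonZero (<-≤-trans (s≤s z≤n) 2≤N)
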